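{- Let $p\ge 11$ be a prime and let $\alpha$ be a $p$-integral rational number. Then $$\binom{\alpha p-1}{p-1}\equiv 1+\alpha(\alpha-1)p\sum_{k=1}^{p-1}\frac{1}{k}+\frac{1}{6}\alpha^{2}(\alpha-1)^{2}p^{3}\sum_{k=1}^{p-1}\frac{1}{k^{3}}\pmod{p^{6}}.$$
   Context: A rational number is $p$-integral if its reduced denominator is not divisible by $p$; for $p$-integral $a,b$, $a\equiv b\pmod{p^k}$ means $(a-b)/p^k$ is $p$-integral. For rational $x$ and integer $n\ge 0$, $\binom{x}{n}=\frac{x(x-1)\cdots(x-n+1)}{n!}$. -}

module Defs where

open import Data.Nat as ℕ using (ℕ; zero; suc)
open import Data.Nat.Divisibility using (_∣_)
open import Data.Integer as ℤ using (ℤ; +_)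
open import Data.Rational using (ℚ; ↧ₙ_; _/_; _+_; _-_; _*_; 0ℚ; 1ℚ)
open import Data.Product using (Σ; _×_)
open import Relation.Binary.PropositionalEquality using (_≡_)
open import Relation.Nullary using (¬_)

ι : ℕ → ℚ
ι n = (+ n) / 1

_^ℚ_ : ℚ → ℕ → ℚ
x ^ℚ zero = 1ℚ
x ^ℚ suc n = x * (x ^ℚ n)

pIntegral : ℕ → ℚ → Set
pIntegral p x = ¬ (p ∣ ↧ₙ x)

CongMod : ℕ → ℕ → ℚ → ℚ → Set
CongMod p k a b =
  pIntegral p a × pIntegral p b ×
  Σ ℚ (λ c → pIntegral p c × (a - b ≡ c * (ι p ^ℚ k)))

binom : ℚ → ℕ → ℚ
binom x zero = 1ℚ
binom x (suc n) = binom x n * ((x - ι n) * ((+ 1) / suc n))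

invPowSum : ℕ → ℕ → ℚ
invPowSum r zero = 0ℚ
invPowSum r (suc n) = invPowSum r n + (((+ 1) / suc n) ^ℚ r)

module Submission where

-- Write p = 2h + 1 and pair k with p - k. Since (αp - k)(αp - (p - k)) = k(p - k)(1 + α(α - 1)p² t_k)
-- with t_k = 1/(k(p - k)), the binomial coefficient is Π_{k ≤ h} (1 + α(α - 1)p² t_k), which is
-- 1 + e₁ + e₂ modulo p⁶. The same pairing gives H₁ = p Σ t_k and H₃ = p³ Σ t_k³ - 3p Σ t_k², so
-- the two sides differ by ½ (α(α - 1)p² Σ t_k)² plus a multiple of p⁶. That square vanishes mod p⁶
-- because Σ t_k ≡ -Σ_{k ≤ h} 1/k² ≡ 0 (mod p).

open import Defs
open import Algebra.Core using (Op₂)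
open import Algebra.Structures using (IsCommutativeMonoid)
open import Data.Integer as ℤ using (+_)
open import Data.Integer.GCD using (gcd)
import Data.Integer.Properties as ℤP
open import Data.Nat as ℕ using (ℕ; zero; suc; _≤_; _<_; _∸_; z≤n; s≤s)
open import Data.Nat.Coprimality using (1-coprimeTo) renaming (sym to coprime-sym)
open import Data.Nat.Divisibility using (_∣_; divides; ∣-trans; >⇒∤)
import Data.Nat.GCD as ℕ
open import Data.Nat.Primality using (Prime; euclidsLemma; composite; prime⇒¬composite; prime⇒nonTrivial)
import Data.Nat.Properties as ℕP
import Data.Nat.Tactic.RingSolver as ℕ-Solver
open import Data.Empty using (⊥-elim)
open import Data.Product using (∃; _,_)
open import Data.Rational as ℚ using (ℚ; mkℚ; ↧ₙ_; ↧_; _/_; _+_; _-_; _*_; -_; 0ℚ; 1ℚ)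
import Data.Rational.Properties as ℚP
open import Data.Sum using (_⊎_; inj₁; inj₂; [_,_]′)
open import Function using (_∘_)
open import Relation.Binary.PropositionalEquality
open import Relation.Nullary.Decidable using (dec⇒maybe)
open import Tactic.RingSolver using (solve-∀)
open import Tactic.RingSolver.Core.AlmostCommutativeRing using (AlmostCommutativeRing; fromCommutativeRing)

open ≡-Reasoning

ℚ-ring : AlmostCommutativeRing _ _
ℚ-ring = fromCommutativeRing ℚP.+-*-commutativeRing (λ x → dec⇒maybe (0ℚ ℚP.≟ x))

↧ₙ-/-∣ : ∀ i n .{{_ : ℕ.NonZero n}} → ↧ₙ (i / n) ∣ n
↧ₙ-/-∣ i n = divides (ℕ.gcd ℤ.∣ i ∣ n) (begin
  n                                 ≡⟨ cong ℤ.∣_∣ (sym (ℚP.↧-/ i n)) ⟩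
  ℤ.∣ ↧ (i / n) ℤ.* gcd i (+ n) ∣    ≡⟨ ℤP.abs-* (↧ (i / n)) (gcd i (+ n)) ⟩
  ↧ₙ (i / n) ℕ.* ℕ.gcd ℤ.∣ i ∣ n    ≡⟨ ℕP.*-comm (↧ₙ (i / n)) _ ⟩
  ℕ.gcd ℤ.∣ i ∣ n ℕ.* ↧ₙ (i / n)    ∎)

↧ₙ-+-∣ : ∀ x y → ↧ₙ (x + y) ∣ ↧ₙ x ℕ.* ↧ₙ y
↧ₙ-+-∣ (mkℚ a b _) (mkℚ c d _) = ↧ₙ-/-∣ (a ℤ.* + suc d ℤ.+ c ℤ.* + suc b) (suc b ℕ.* suc d)

↧ₙ-*-∣ : ∀ x y → ↧ₙ (x * y) ∣ ↧ₙ x ℕ.* ↧ₙ y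
↧ₙ-*-∣ (mkℚ a b _) (mkℚ c d _) = ↧ₙ-/-∣ (a ℤ.* c) (suc b ℕ.* suc d)

↧ₙ-neg : ∀ x → ↧ₙ (- x) ≡ ↧ₙ x
↧ₙ-neg x = cong ℤ.∣_∣ (ℚP.↧-neg x)

ι≡mkℚ : ∀ n → ι n ≡ mkℚ (+ n) 0 (coprime-sym (1-coprimeTo n))
ι≡mkℚ n = ℚP.normalize-coprime (coprime-sym (1-coprimeTo n))

ι-+ : ∀ m n → ι (m ℕ.+ n) ≡ ι m + ι n
ι-+ m n rewrite ι≡mkℚ m | ι≡mkℚ n = ℚP./-cong (sym numerator) refl
  where
  numerator : + m ℤ.* + 1 ℤ.+ + n ℤ.* + 1 ≡ + (m ℕ.+ n)
  numerator rewrite ℤP.*-identityʳ (+ m) | ℤP.*-identityʳ (+ n) = sym (ℤP.pos-+ m n)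

ι-suc : ∀ n → ι (suc n) ≡ 1ℚ + ι n
ι-suc = ι-+ 1

ι-*-1/ : ∀ n → ι (suc n) * ((+ 1) / suc n) ≡ 1ℚ
ι-*-1/ n rewrite ι≡mkℚ (suc n) | ℚP.normalize-coprime (1-coprimeTo (suc n))
  = ℚP.*-inverseʳ (mkℚ (+ suc n) 0 (coprime-sym (1-coprimeTo (suc n))))

^ℚ-distribˡ-+-* : ∀ x m n → x ^ℚ (m ℕ.+ n) ≡ x ^ℚ m * x ^ℚ n
^ℚ-distribˡ-+-* x zero    n = sym (ℚP.*-identityˡ _)
^ℚ-distribˡ-+-* x (suc m) n = trans (cong (x *_) (^ℚ-distribˡ-+-* x m n)) (sym (ℚP.*-assoc x _ _))

module Fold {A : Set} {_∙_ : Op₂ A} {ε : A} (isCommutativeMonoid : IsCommutativeMonoid _≡_ _∙_ ε) where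

  open IsCommutativeMonoid isCommutativeMonoid using (assoc; comm; identityˡ; identityʳ)

  fold : ℕ → (ℕ → A) → A
  fold zero    f = ε
  fold (suc n) f = fold n f ∙ f n

  fold-cong : ∀ n {f g} → (∀ i → i < n → f i ≡ g i) → fold n f ≡ fold n g
  fold-cong zero    f≡g = refl
  fold-cong (suc n) f≡g = cong₂ _∙_ (fold-cong n (λ i i<n → f≡g i (ℕP.m<n⇒m<1+n i<n))) (f≡g n ℕP.≤-refl)

  fold-map : (φ : A → A) → φ ε ≡ ε → (∀ x y → φ (x ∙ y) ≡ φ x ∙ φ y) →
             ∀ n f → fold n (φ ∘ f) ≡ φ (fold n f)
  fold-map φ φε φ∙ zero    f = sym φε
  fold-map φ φε φ∙ (suc n) f = trans (cong (_∙ φ (f n)) (fold-map φ φε φ∙ n f)) (sym (φ∙ _ _))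

  fold-suc : ∀ n f → fold (suc n) f ≡ f 0 ∙ fold n (f ∘ suc)
  fold-suc zero    f = trans (identityˡ _) (sym (identityʳ _))
  fold-suc (suc n) f = trans (cong (_∙ f (suc n)) (fold-suc n f)) (assoc _ _ _)

  fold-reverse : ∀ n f → fold n f ≡ fold n (λ i → f (n ∸ suc i))
  fold-reverse zero    f = refl
  fold-reverse (suc n) f = begin
    fold n f ∙ f n                               ≡⟨ comm _ _ ⟩
    f n ∙ fold n f                               ≡⟨ cong (f n ∙_) (fold-reverse n f) ⟩
    f n ∙ fold n (λ i → f (n ∸ suc i))           ≡⟨ sym (fold-suc n (λ i → f (suc n ∸ suc i))) ⟩
    fold (suc n) (λ i → f (suc n ∸ suc i))       ∎

  fold-+ : ∀ m n f → fold (m ℕ.+ n) f ≡ fold m f ∙ fold n (λ i → f (m ℕ.+ i))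
  fold-+ m zero    f = trans (cong (λ k → fold k f) (ℕP.+-identityʳ m)) (sym (identityʳ _))
  fold-+ m (suc n) f = begin
    fold (m ℕ.+ suc n) f                                  ≡⟨ cong (λ k → fold k f) (ℕP.+-suc m n) ⟩
    fold (m ℕ.+ n) f ∙ f (m ℕ.+ n)                        ≡⟨ cong (_∙ f (m ℕ.+ n)) (fold-+ m n f) ⟩
    (fold m f ∙ fold n (λ i → f (m ℕ.+ i))) ∙ f (m ℕ.+ n) ≡⟨ assoc _ _ _ ⟩
    fold m f ∙ fold (suc n) (λ i → f (m ℕ.+ i))           ∎

  fold-∙ : ∀ n f g → fold n f ∙ fold n g ≡ fold n (λ i → f i ∙ g i)
  fold-∙ zero    f g = identityˡ ε
  fold-∙ (suc n) f g = begin
    (fold n f ∙ f n) ∙ (fold n g ∙ g n)   ≡⟨ assoc _ _ _ ⟩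
    fold n f ∙ (f n ∙ (fold n g ∙ g n))   ≡⟨ cong (fold n f ∙_) (sym (assoc _ _ _)) ⟩
    fold n f ∙ ((f n ∙ fold n g) ∙ g n)   ≡⟨ cong (λ x → fold n f ∙ (x ∙ g n)) (comm _ _) ⟩
    fold n f ∙ ((fold n g ∙ f n) ∙ g n)   ≡⟨ cong (fold n f ∙_) (assoc _ _ _) ⟩
    fold n f ∙ (fold n g ∙ (f n ∙ g n))   ≡⟨ sym (assoc _ _ _) ⟩
    (fold n f ∙ fold n g) ∙ (f n ∙ g n)   ≡⟨ cong (_∙ (f n ∙ g n)) (fold-∙ n f g) ⟩
    fold n (λ i → f i ∙ g i) ∙ (f n ∙ g n) ∎

  fold-pair : ∀ h f → fold (h ℕ.+ h) f ≡ fold h (λ i → f i ∙ f (h ℕ.+ h ∸ suc i))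
  fold-pair h f = begin
    fold (h ℕ.+ h) f                                         ≡⟨ fold-+ h h f ⟩
    fold h f ∙ fold h (λ i → f (h ℕ.+ i))                    ≡⟨ cong (fold h f ∙_) (fold-reverse h _) ⟩
    fold h f ∙ fold h (λ i → f (h ℕ.+ (h ∸ suc i)))          ≡⟨ fold-∙ h f _ ⟩
    fold h (λ i → f i ∙ f (h ℕ.+ (h ∸ suc i)))               ≡⟨ fold-cong h (λ i i<h →
                                                                  cong (λ k → f i ∙ f k) (sym (ℕP.+-∸-assoc h i<h))) ⟩
    fold h (λ i → f i ∙ f (h ℕ.+ h ∸ suc i))                 ∎

  fold-evenOdd : ∀ h f → fold (h ℕ.+ h) f ≡ fold h (λ i → f (i ℕ.+ i) ∙ f (suc (i ℕ.+ i)))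
  fold-evenOdd zero    f = refl
  fold-evenOdd (suc h) f rewrite ℕP.+-suc h h =
    trans (assoc _ _ _) (cong (_∙ (f (h ℕ.+ h) ∙ f (suc (h ℕ.+ h)))) (fold-evenOdd h f))

module Σ = Fold ℚP.+-0-isCommutativeMonoid
module Π = Fold ℚP.*-1-isCommutativeMonoid

Σ-*ˡ : ∀ c n f → Σ.fold n (λ i → c * f i) ≡ c * Σ.fold n f
Σ-*ˡ c = Σ.fold-map (c *_) (ℚP.*-zeroʳ c) (ℚP.*-distribˡ-+ c)

Σ-sub : ∀ n f g → Σ.fold n (λ i → f i - g i) ≡ Σ.fold n f - Σ.fold n g
Σ-sub n f g = begin
  Σ.fold n (λ i → f i - g i)          ≡⟨ sym (Σ.fold-∙ n f (λ i → - g i)) ⟩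
  Σ.fold n f + Σ.fold n (λ i → - g i) ≡⟨ cong (λ x → Σ.fold n f + x) (Σ.fold-map -_ refl ℚP.neg-distrib-+ n g) ⟩
  Σ.fold n f - Σ.fold n g             ∎

invPowSum≡Σ : ∀ k n → invPowSum k n ≡ Σ.fold n (λ i → ((+ 1) / suc i) ^ℚ k)
invPowSum≡Σ k zero    = refl
invPowSum≡Σ k (suc n) = cong (_+ ((+ 1) / suc n) ^ℚ k) (invPowSum≡Σ k n)

binom≡Π : ∀ x n → binom x n ≡ Π.fold n (λ i → (x - ι i) * ((+ 1) / suc i))
binom≡Π x zero    = refl
binom≡Π x (suc n) = cong (_* ((x - ι n) * ((+ 1) / suc n))) (binom≡Π x n)

e₂ : (ℕ → ℚ) → ℕ → ℚ
e₂ y zero    = 0ℚ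
e₂ y (suc n) = e₂ y n + Σ.fold n y * y n

e₂-newton : ∀ y n → e₂ y n ≡ ((+ 1) / 2) * (Σ.fold n y * Σ.fold n y - Σ.fold n (λ i → y i * y i))
e₂-newton y zero    = refl
e₂-newton y (suc n) rewrite e₂-newton y n = identity (Σ.fold n y) (Σ.fold n (λ i → y i * y i)) (y n)
  where
  identity : ∀ e q z → ((+ 1) / 2) * (e * e - q) + e * z ≡ ((+ 1) / 2) * ((e + z) * (e + z) - (q + z * z))
  identity = solve-∀ ℚ-ring

reciprocal-sum : ∀ a b c r s → a * r ≡ 1ℚ → b * s ≡ 1ℚ → a + b ≡ c → r + s ≡ c * (r * s)
reciprocal-sum a b c r s ar≡1 bs≡1 a+b≡c = begin
  r + s                      ≡⟨ identityˡ r s ⟩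
  1ℚ * s + 1ℚ * r            ≡⟨ cong₂ (λ x y → x * s + y * r) (sym ar≡1) (sym bs≡1) ⟩
  (a * r) * s + (b * s) * r  ≡⟨ identityʳ a b r s ⟩
  (a + b) * (r * s)          ≡⟨ cong (_* (r * s)) a+b≡c ⟩
  c * (r * s)                ∎
  where
  identityˡ : ∀ r s → r + s ≡ 1ℚ * s + 1ℚ * r
  identityˡ = solve-∀ ℚ-ring
  identityʳ : ∀ a b r s → (a * r) * s + (b * s) * r ≡ (a + b) * (r * s)
  identityʳ = solve-∀ ℚ-ring

difference-of-squares : ∀ c r s t → r + s ≡ c * t → s * s - r * r ≡ c * ((s - r) * t)
difference-of-squares c r s t r+s≡ct = begin
  s * s - r * r        ≡⟨ factor r s ⟩
  (s - r) * (r + s)    ≡⟨ cong ((s - r) *_) r+s≡ct ⟩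
  (s - r) * (c * t)    ≡⟨ regroup c (s - r) t ⟩
  c * ((s - r) * t)    ∎
  where
  factor : ∀ r s → s * s - r * r ≡ (s - r) * (r + s)
  factor = solve-∀ ℚ-ring
  regroup : ∀ c x t → x * (c * t) ≡ c * (x * t)
  regroup = solve-∀ ℚ-ring

product-plus-square : ∀ c r s t → r + s ≡ c * t → r * s + r * r ≡ c * (r * t)
product-plus-square c r s t r+s≡ct = begin
  r * s + r * r   ≡⟨ factor r s ⟩
  r * (r + s)     ≡⟨ cong (r *_) r+s≡ct ⟩
  r * (c * t)     ≡⟨ regroup c r t ⟩
  c * (r * t)     ∎
  where
  factor : ∀ r s → r * s + r * r ≡ r * (r + s)
  factor = solve-∀ ℚ-ring
  regroup : ∀ c r t → r * (c * t) ≡ c * (r * t)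
  regroup = solve-∀ ℚ-ring

sum-of-cubes : ∀ c r s → r + s ≡ c * (r * s) →
  r ^ℚ 3 + s ^ℚ 3 ≡ c * c * c * (r * s * (r * s) * (r * s)) - ι 3 * c * (r * s * (r * s))
sum-of-cubes c r s r+s≡crs = begin
  r ^ℚ 3 + s ^ℚ 3                                         ≡⟨ expand r s ⟩
  (r + s) * (r + s) * (r + s) - ι 3 * (r * s) * (r + s)   ≡⟨ cong (λ σ → σ * σ * σ - ι 3 * (r * s) * σ) r+s≡crs ⟩
  c * (r * s) * (c * (r * s)) * (c * (r * s)) - ι 3 * (r * s) * (c * (r * s))
                                                          ≡⟨ collect c (r * s) ⟩
  c * c * c * (r * s * (r * s) * (r * s)) - ι 3 * c * (r * s * (r * s)) ∎
  where
  expand : ∀ r s → r * (r * (r * 1ℚ)) + s * (s * (s * 1ℚ)) ≡ (r + s) * (r + s) * (r + s) - ι 3 * (r * s) * (r + s)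
  expand = solve-∀ ℚ-ring
  collect : ∀ c t → c * t * (c * t) * (c * t) - ι 3 * t * (c * t) ≡ c * c * c * (t * t * t) - ι 3 * c * (t * t)
  collect = solve-∀ ℚ-ring

paired-factors : ∀ α c a b r s → (1ℚ + a) * r ≡ 1ℚ → (1ℚ + b) * s ≡ 1ℚ → (1ℚ + a) + (1ℚ + b) ≡ c →
  ((α * c - 1ℚ) - a) * r * (((α * c - 1ℚ) - b) * s) ≡ 1ℚ + α * (α - 1ℚ) * (c * c) * (r * s)
paired-factors α c a b r s a'r≡1 b's≡1 a'+b'≡c = begin
  ((α * c - 1ℚ) - a) * r * (((α * c - 1ℚ) - b) * s)
    ≡⟨ separate α c a b r s ⟩
  (α * c * r - (1ℚ + a) * r) * (α * c * s - (1ℚ + b) * s)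
    ≡⟨ cong₂ (λ x y → (α * c * r - x) * (α * c * s - y)) a'r≡1 b's≡1 ⟩
  (α * c * r - 1ℚ) * (α * c * s - 1ℚ)
    ≡⟨ expand α c r s ⟩
  1ℚ + α * α * (c * c) * (r * s) - α * c * (r + s)
    ≡⟨ cong (λ x → 1ℚ + α * α * (c * c) * (r * s) - α * c * x) (reciprocal-sum (1ℚ + a) (1ℚ + b) c r s a'r≡1 b's≡1 a'+b'≡c) ⟩
  1ℚ + α * α * (c * c) * (r * s) - α * c * (c * (r * s))
    ≡⟨ collect α c r s ⟩
  1ℚ + α * (α - 1ℚ) * (c * c) * (r * s) ∎
  where
  separate : ∀ α c a b r s → ((α * c - 1ℚ) - a) * r * (((α * c - 1ℚ) - b) * s)
                           ≡ (α * c * r - (1ℚ + a) * r) * (α * c * s - (1ℚ + b) * s)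
  separate = solve-∀ ℚ-ring
  expand : ∀ α c r s → (α * c * r - 1ℚ) * (α * c * s - 1ℚ) ≡ 1ℚ + α * α * (c * c) * (r * s) - α * c * (r + s)
  expand = solve-∀ ℚ-ring
  collect : ∀ α c r s → 1ℚ + α * α * (c * c) * (r * s) - α * c * (c * (r * s)) ≡ 1ℚ + α * (α - 1ℚ) * (c * c) * (r * s)
  collect = solve-∀ ℚ-ring

halve-reciprocal : ∀ a r v → (a + a) * v ≡ 1ℚ → a * r ≡ 1ℚ → v ≡ ((+ 1) / 2) * r
halve-reciprocal a r v 2av≡1 ar≡1 = begin
  v                                    ≡⟨ sym (ℚP.*-identityʳ v) ⟩
  v * 1ℚ                               ≡⟨ cong (v *_) (sym ar≡1) ⟩
  v * (a * r)                          ≡⟨ regroup a r v ⟩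
  (a + a) * v * (((+ 1) / 2) * r)      ≡⟨ cong (_* (((+ 1) / 2) * r)) 2av≡1 ⟩
  1ℚ * (((+ 1) / 2) * r)               ≡⟨ ℚP.*-identityˡ _ ⟩
  ((+ 1) / 2) * r                      ∎
  where
  regroup : ∀ a r v → v * (a * r) ≡ (a + a) * v * (((+ 1) / 2) * r)
  regroup = solve-∀ ℚ-ring

half-squared : ∀ x y → x ≡ ((+ 1) / 2) * y → x * x ≡ ((+ 1) / 4) * (y * y)
half-squared x y x≡y/2 = trans (cong (λ z → z * z) x≡y/2) (quarter y)
  where
  quarter : ∀ y → ((+ 1) / 2) * y * (((+ 1) / 2) * y) ≡ ((+ 1) / 4) * (y * y)
  quarter = solve-∀ ℚ-ring

even-or-odd : ∀ n → ∃ (λ h → n ≡ h ℕ.+ h) ⊎ ∃ (λ h → n ≡ suc (h ℕ.+ h))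
even-or-odd zero = inj₁ (0 , refl)
even-or-odd (suc n) with even-or-odd n
... | inj₁ (h , refl) = inj₂ (h , refl)
... | inj₂ (h , refl) = inj₁ (suc h , cong suc (sym (ℕP.+-suc h h)))

odd-prime : ∀ {p} → Prime p → 2 < p → ∃ λ h → p ≡ suc (h ℕ.+ h)
odd-prime {p} p-prime 2<p with even-or-odd p
... | inj₂ odd = odd
... | inj₁ (h , refl) = ⊥-elim (prime⇒¬composite p-prime (composite {2} 2<p (divides h h+h≡h*2)))
  where
  h+h≡h*2 : h ℕ.+ h ≡ h ℕ.* 2
  h+h≡h*2 = trans (cong (h ℕ.+_) (sym (ℕP.+-identityʳ h))) (ℕP.*-comm 2 h)

module PAdic (p : ℕ) (p-prime : Prime p) where

  -- A record rather than pIntegral itself, so that x can be inferred.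
  record Integral (x : ℚ) : Set where
    constructor integral
    field p∤↧ₙ : pIntegral p x

  integral-∣ : ∀ {x y z} → ↧ₙ z ∣ ↧ₙ x ℕ.* ↧ₙ y → Integral x → Integral y → Integral z
  integral-∣ z∣xy (integral p∤x) (integral p∤y) =
    integral (λ p∣z → [ p∤x , p∤y ]′ (euclidsLemma _ _ p-prime (∣-trans p∣z z∣xy)))

  +-integral : ∀ {x y} → Integral x → Integral y → Integral (x + y)
  +-integral {x} {y} = integral-∣ (↧ₙ-+-∣ x y)

  *-integral : ∀ {x y} → Integral x → Integral y → Integral (x * y)
  *-integral {x} {y} = integral-∣ (↧ₙ-*-∣ x y)

  neg-integral : ∀ {x} → Integral x → Integral (- x)
  neg-integral {x} (integral p∤x) = integral (p∤x ∘ subst (p ∣_) (↧ₙ-neg x))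

  sub-integral : ∀ {x y} → Integral x → Integral y → Integral (x - y)
  sub-integral x-int y-int = +-integral x-int (neg-integral y-int)

  /-integral : ∀ i n .{{_ : ℕ.NonZero n}} → n < p → Integral (i / n)
  /-integral i n n<p = integral (λ p∣↧ → >⇒∤ n<p (∣-trans p∣↧ (↧ₙ-/-∣ i n)))

  ι-integral : ∀ n → Integral (ι n)
  ι-integral n = /-integral (+ n) 1 (ℕ.nonTrivial⇒n>1 p {{prime⇒nonTrivial p-prime}})

  ^-integral : ∀ {x} n → Integral x → Integral (x ^ℚ n)
  ^-integral zero    x-int = ι-integral 1
  ^-integral (suc n) x-int = *-integral x-int (^-integral n x-int)

  Σ-integral : ∀ n {f} → (∀ i → i < n → Integral (f i)) → Integral (Σ.fold n f)
  Σ-integral zero    f-int = ι-integral 0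
  Σ-integral (suc n) f-int = +-integral (Σ-integral n (λ i i<n → f-int i (ℕP.m<n⇒m<1+n i<n))) (f-int n ℕP.≤-refl)

  invPowSum-integral : ∀ k n → n < p → Integral (invPowSum k n)
  invPowSum-integral k zero    _   = ι-integral 0
  invPowSum-integral k (suc n) n<p =
    +-integral (invPowSum-integral k n (ℕP.<⇒≤ n<p)) (^-integral k (/-integral (+ 1) (suc n) n<p))

  infix 4 p^_∣_
  record p^_∣_ (k : ℕ) (x : ℚ) : Set where
    constructor multiple
    field
      quotient          : ℚ
      quotient-integral : Integral quotient
      x≡quotient*p^k    : x ≡ quotient * ι p ^ℚ k

  p^∣0 : ∀ {k} → p^ k ∣ 0ℚ
  p^∣0 {k} = multiple 0ℚ (ι-integral 0) (sym (ℚP.*-zeroˡ (ι p ^ℚ k)))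

  p^∣-+ : ∀ {k x y} → p^ k ∣ x → p^ k ∣ y → p^ k ∣ x + y
  p^∣-+ {k} (multiple a a-int refl) (multiple b b-int refl) =
    multiple (a + b) (+-integral a-int b-int) (sym (ℚP.*-distribʳ-+ (ι p ^ℚ k) a b))

  p^∣-neg : ∀ {k x} → p^ k ∣ x → p^ k ∣ - x
  p^∣-neg {k} (multiple a a-int refl) = multiple (- a) (neg-integral a-int) (ℚP.neg-distribˡ-* a _)

  p^∣-sub : ∀ {k x y} → p^ k ∣ x → p^ k ∣ y → p^ k ∣ x - y
  p^∣-sub x∣ y∣ = p^∣-+ x∣ (p^∣-neg y∣)

  p^∣-*ˡ : ∀ {k x y} → Integral x → p^ k ∣ y → p^ k ∣ x * y
  p^∣-*ˡ {k} {x} x-int (multiple b b-int refl) = multiple (x * b) (*-integral x-int b-int) (sym (ℚP.*-assoc x b _))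

  p^∣-*ʳ : ∀ {k x y} → p^ k ∣ x → Integral y → p^ k ∣ x * y
  p^∣-*ʳ {x = x} {y} x∣ y-int = subst (p^ _ ∣_) (ℚP.*-comm y x) (p^∣-*ˡ y-int x∣)

  p^∣-* : ∀ {j k x y} → p^ j ∣ x → p^ k ∣ y → p^ (j ℕ.+ k) ∣ x * y
  p^∣-* {j} {k} (multiple a a-int refl) (multiple b b-int refl) = multiple (a * b) (*-integral a-int b-int) (begin
    a * ι p ^ℚ j * (b * ι p ^ℚ k)      ≡⟨ interchange a b (ι p ^ℚ j) (ι p ^ℚ k) ⟩
    a * b * (ι p ^ℚ j * ι p ^ℚ k)      ≡⟨ cong (a * b *_) (sym (^ℚ-distribˡ-+-* (ι p) j k)) ⟩
    a * b * ι p ^ℚ (j ℕ.+ k)           ∎)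
    where
    interchange : ∀ a b x y → a * x * (b * y) ≡ a * b * (x * y)
    interchange = solve-∀ ℚ-ring

  p^1∣p* : ∀ {x} → Integral x → p^ 1 ∣ ι p * x
  p^1∣p* {x} x-int = multiple x x-int (trans (ℚP.*-comm (ι p) x) (cong (x *_) (sym (ℚP.*-identityʳ (ι p)))))

  p^∣⇒integral : ∀ {k x} → p^ k ∣ x → Integral x
  p^∣⇒integral {k} (multiple a a-int refl) = *-integral a-int (^-integral k (ι-integral p))

  p^∣-Σ : ∀ {k} n {f} → (∀ i → i < n → p^ k ∣ f i) → p^ k ∣ Σ.fold n f
  p^∣-Σ zero    f∣ = p^∣0
  p^∣-Σ (suc n) f∣ = p^∣-+ (p^∣-Σ n (λ i i<n → f∣ i (ℕP.m<n⇒m<1+n i<n))) (f∣ n ℕP.≤-refl)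

  p^∣-Σ-sub : ∀ {k} n {f g} → (∀ i → i < n → p^ k ∣ f i - g i) → p^ k ∣ Σ.fold n f - Σ.fold n g
  p^∣-Σ-sub n {f} {g} f-g∣ = subst (p^ _ ∣_) (Σ-sub n f g) (p^∣-Σ n f-g∣)

  e₂-multiple : ∀ {k} n {y} → (∀ i → i < n → p^ k ∣ y i) → p^ (k ℕ.+ k) ∣ e₂ y n
  e₂-multiple zero    y∣ = p^∣0
  e₂-multiple {k} (suc n) {y} y∣ = p^∣-+ (e₂-multiple n y∣<n) (p^∣-* (p^∣-Σ n y∣<n) (y∣ n ℕP.≤-refl))
    where
    y∣<n : ∀ i → i < n → p^ k ∣ y i
    y∣<n i i<n = y∣ i (ℕP.m<n⇒m<1+n i<n)

  Π[1+y]≡1+e₁+e₂ : ∀ {k} n {y} → (∀ i → i < n → p^ k ∣ y i) →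
    p^ (k ℕ.+ k ℕ.+ k) ∣ Π.fold n (λ i → 1ℚ + y i) - (1ℚ + Σ.fold n y + e₂ y n)
  Π[1+y]≡1+e₁+e₂ zero    y∣ = p^∣0
  Π[1+y]≡1+e₁+e₂ {k} (suc n) {y} y∣ = subst (p^ _ ∣_) (sym (step (Π.fold n (λ i → 1ℚ + y i)) (Σ.fold n y) (e₂ y n) (y n)))
    (p^∣-+ (p^∣-*ʳ (Π[1+y]≡1+e₁+e₂ n y∣<n) (+-integral (ι-integral 1) (p^∣⇒integral (y∣ n ℕP.≤-refl))))
           (p^∣-* (e₂-multiple n y∣<n) (y∣ n ℕP.≤-refl)))
    where
    y∣<n : ∀ i → i < n → p^ k ∣ y i
    y∣<n i i<n = y∣ i (ℕP.m<n⇒m<1+n i<n)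
    step : ∀ π e₁ e₂ z → π * (1ℚ + z) - (1ℚ + (e₁ + z) + (e₂ + e₁ * z)) ≡ (π - (1ℚ + e₁ + e₂)) * (1ℚ + z) + e₂ * z
    step = solve-∀ ℚ-ring

  congMod : ∀ {k a b} → Integral b → p^ k ∣ a - b → CongMod p k a b
  congMod {k} {a} {b} b-int a-b∣@(multiple c c-int eq) = p∤↧ₙ a-int , p∤↧ₙ b-int , c , p∤↧ₙ c-int , eq
    where
    open Integral
    a-int : Integral a
    a-int = subst Integral (restore a b) (+-integral (p^∣⇒integral a-b∣) b-int)
      where
      restore : ∀ a b → a - b + b ≡ a
      restore = solve-∀ ℚ-ring

module OddPrime (h : ℕ) (p-prime : Prime (suc (h ℕ.+ h))) (7≤p : 7 ≤ suc (h ℕ.+ h)) where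

  p : ℕ
  p = suc (h ℕ.+ h)

  P : ℚ
  P = ι p

  open PAdic p p-prime

  r : ℕ → ℚ
  r i = (+ 1) / suc i

  -- With k = i + 1, mirror sends k to p - k, so r̄ i = 1 / (p - k) is the partner of r i = 1 / k.
  mirror : ℕ → ℕ
  mirror i = h ℕ.+ h ∸ suc i

  r̄ : ℕ → ℚ
  r̄ i = r (mirror i)

  t : ℕ → ℚ
  t i = r i * r̄ i

  <h⇒<2h : ∀ {i} → i < h → i < h ℕ.+ h
  <h⇒<2h i<h = ℕP.≤-trans i<h (ℕP.m≤m+n h h)

  complement-sum : ∀ {i} → i < h ℕ.+ h → suc i ℕ.+ suc (mirror i) ≡ p
  complement-sum i<2h = trans (ℕP.+-suc (suc _) _) (cong suc (ℕP.m+[n∸m]≡n i<2h))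

  r-integral : ∀ {i} → i < h ℕ.+ h → Integral (r i)
  r-integral {i} i<2h = /-integral (+ 1) (suc i) (s≤s i<2h)

  r̄-integral : ∀ {i} → i < h ℕ.+ h → Integral (r̄ i)
  r̄-integral {i} i<2h = /-integral (+ 1) (suc (mirror i)) mirror<p
    where
    mirror<p : suc (mirror i) < p
    mirror<p = subst (suc (mirror i) <_) (complement-sum i<2h) (ℕP.m<n+m (suc (mirror i)) {suc i} (s≤s z≤n))

  t-integral : ∀ {i} → i < h ℕ.+ h → Integral (t i)
  t-integral i<2h = *-integral (r-integral i<2h) (r̄-integral i<2h)

  ι-complement-sum : ∀ {i} → i < h ℕ.+ h → ι (suc i) + ι (suc (mirror i)) ≡ P
  ι-complement-sum {i} i<2h = trans (sym (ι-+ (suc i) (suc (mirror i)))) (cong ι (complement-sum i<2h))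

  r+r̄ : ∀ {i} → i < h ℕ.+ h → r i + r̄ i ≡ P * t i
  r+r̄ {i} i<2h = reciprocal-sum (ι (suc i)) (ι (suc (mirror i))) P (r i) (r̄ i)
    (ι-*-1/ i) (ι-*-1/ (mirror i)) (ι-complement-sum i<2h)

  r̄²≡r² : ∀ {i} → i < h ℕ.+ h → p^ 1 ∣ r̄ i * r̄ i - r i * r i
  r̄²≡r² {i} i<2h = subst (p^ 1 ∣_) (sym (difference-of-squares P (r i) (r̄ i) (t i) (r+r̄ i<2h)))
    (p^1∣p* (*-integral (sub-integral (r̄-integral i<2h) (r-integral i<2h)) (t-integral i<2h)))

  t≡-r² : ∀ {i} → i < h ℕ.+ h → p^ 1 ∣ t i + r i * r i
  t≡-r² {i} i<2h = subst (p^ 1 ∣_) (sym (product-plus-square P (r i) (r̄ i) (t i) (r+r̄ i<2h)))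
    (p^1∣p* (*-integral (r-integral i<2h) (t-integral i<2h)))

  r[2i+1]≡r[i]/2 : ∀ i → r (suc (i ℕ.+ i)) ≡ ((+ 1) / 2) * r i
  r[2i+1]≡r[i]/2 i = halve-reciprocal (ι (suc i)) (r i) (r (suc (i ℕ.+ i)))
    (trans (cong (_* r (suc (i ℕ.+ i))) (sym ι2i+2≡)) (ι-*-1/ (suc (i ℕ.+ i)))) (ι-*-1/ i)
    where
    ι2i+2≡ : ι (suc (suc (i ℕ.+ i))) ≡ ι (suc i) + ι (suc i)
    ι2i+2≡ = trans (cong (ι ∘ suc) (sym (ℕP.+-suc i i))) (ι-+ (suc i) (suc i))

  r̄[2i]≡r[2m+1] : ∀ {i} → i < h → r̄ (i ℕ.+ i) ≡ r (suc ((h ∸ suc i) ℕ.+ (h ∸ suc i)))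
  r̄[2i]≡r[2m+1] {i} i<h = cong r (begin
    h ℕ.+ h ∸ suc (i ℕ.+ i)                  ≡⟨ cong (λ x → x ℕ.+ x ∸ suc (i ℕ.+ i)) (sym (ℕP.m+[n∸m]≡n i<h)) ⟩
    suc i ℕ.+ m ℕ.+ (suc i ℕ.+ m) ∸ suc (i ℕ.+ i) ≡⟨ cong (_∸ suc (i ℕ.+ i)) (regroup i m) ⟩
    suc (i ℕ.+ i) ℕ.+ suc (m ℕ.+ m) ∸ suc (i ℕ.+ i) ≡⟨ ℕP.m+n∸m≡n (suc (i ℕ.+ i)) _ ⟩
    suc (m ℕ.+ m)                            ∎)
    where
    m : ℕ
    m = h ∸ suc i
    regroup : ∀ i m → suc i ℕ.+ m ℕ.+ (suc i ℕ.+ m) ≡ suc (i ℕ.+ i) ℕ.+ suc (m ℕ.+ m)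
    regroup = ℕ-Solver.solve-∀

  T : ℚ
  T = Σ.fold h (λ i → r i * r i)

  S : ℚ
  S = Σ.fold (h ℕ.+ h) (λ i → r i * r i)

  E : ℚ
  E = Σ.fold h t

  S≡2T : p^ 1 ∣ S - (T + T)
  S≡2T = subst (p^ 1 ∣_) (cong₂ _-_ (sym (Σ.fold-pair h _)) (sym (Σ.fold-∙ h _ _)))
    (p^∣-Σ-sub h (λ i i<h → subst (p^ 1 ∣_) (cancel (r i * r i) (r̄ i * r̄ i)) (r̄²≡r² (<h⇒<2h i<h))))
    where
    cancel : ∀ a b → b - a ≡ (a + b) - (a + a)
    cancel = solve-∀ ℚ-ring

  Σr[2i+1]²≡T/4 : Σ.fold h (λ i → r (suc (i ℕ.+ i)) * r (suc (i ℕ.+ i))) ≡ ((+ 1) / 4) * T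
  Σr[2i+1]²≡T/4 = trans (Σ.fold-cong h (λ i _ → half-squared _ (r i) (r[2i+1]≡r[i]/2 i))) (Σ-*ˡ ((+ 1) / 4) h _)

  Σr̄[2i]²≡T/4 : Σ.fold h (λ i → r̄ (i ℕ.+ i) * r̄ (i ℕ.+ i)) ≡ ((+ 1) / 4) * T
  Σr̄[2i]²≡T/4 = begin
    Σ.fold h (λ i → r̄ (i ℕ.+ i) * r̄ (i ℕ.+ i))
      ≡⟨ Σ.fold-cong h (λ i i<h → half-squared (r̄ (i ℕ.+ i)) (r (h ∸ suc i)) (trans (r̄[2i]≡r[2m+1] i<h) (r[2i+1]≡r[i]/2 (h ∸ suc i)))) ⟩
    Σ.fold h (λ i → ((+ 1) / 4) * (r (h ∸ suc i) * r (h ∸ suc i)))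
      ≡⟨ Σ-*ˡ ((+ 1) / 4) h _ ⟩
    ((+ 1) / 4) * Σ.fold h (λ i → r (h ∸ suc i) * r (h ∸ suc i))
      ≡⟨ cong (((+ 1) / 4) *_) (sym (Σ.fold-reverse h _)) ⟩
    ((+ 1) / 4) * T ∎

  -- Splitting S into even and odd k and replacing 1/k² by 1/(p-k)² for odd k gives ¼T + ¼T.
  S≡T/2 : p^ 1 ∣ S - ((+ 1) / 2) * T
  S≡T/2 = subst (p^ 1 ∣_) (cong₂ _-_ (sym (Σ.fold-evenOdd h _)) half-T)
    (p^∣-Σ-sub h (λ i i<h → subst (p^ 1 ∣_) (cancel (r (i ℕ.+ i) * r (i ℕ.+ i)) (r̄ (i ℕ.+ i) * r̄ (i ℕ.+ i)) _)
                                   (p^∣-neg (r̄²≡r² (ℕP.+-mono-< i<h i<h)))))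
    where
    cancel : ∀ a b c → - (b - a) ≡ (a + c) - (b + c)
    cancel = solve-∀ ℚ-ring
    halve : ∀ x → ((+ 1) / 4) * x + ((+ 1) / 4) * x ≡ ((+ 1) / 2) * x
    halve = solve-∀ ℚ-ring
    half-T : Σ.fold h (λ i → r̄ (i ℕ.+ i) * r̄ (i ℕ.+ i) + r (suc (i ℕ.+ i)) * r (suc (i ℕ.+ i))) ≡ ((+ 1) / 2) * T
    half-T = trans (sym (Σ.fold-∙ h _ _)) (trans (cong₂ _+_ Σr̄[2i]²≡T/4 Σr[2i+1]²≡T/4) (halve T))

  T≡0 : p^ 1 ∣ T
  T≡0 = subst (p^ 1 ∣_) (sym (combine T S)) (p^∣-*ˡ (/-integral (+ 2) 3 3<p) (p^∣-sub S≡T/2 S≡2T))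
    where
    3<p : 3 < p
    3<p = ℕP.≤-trans (ℕP.m≤m+n 4 3) 7≤p
    combine : ∀ T S → T ≡ ((+ 2) / 3) * ((S - ((+ 1) / 2) * T) - (S - (T + T)))
    combine = solve-∀ ℚ-ring

  E≡0 : p^ 1 ∣ E
  E≡0 = subst (p^ 1 ∣_) (restore E T)
    (p^∣-sub (subst (p^ 1 ∣_) (sym (Σ.fold-∙ h t _)) (p^∣-Σ h (λ i i<h → t≡-r² (<h⇒<2h i<h)))) T≡0)
    where
    restore : ∀ E T → E + T - T ≡ E
    restore = solve-∀ ℚ-ring

  H₁≡PE : invPowSum 1 (h ℕ.+ h) ≡ P * E
  H₁≡PE = begin
    invPowSum 1 (h ℕ.+ h)                    ≡⟨ invPowSum≡Σ 1 (h ℕ.+ h) ⟩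
    Σ.fold (h ℕ.+ h) (λ i → r i ^ℚ 1)        ≡⟨ Σ.fold-pair h _ ⟩
    Σ.fold h (λ i → r i ^ℚ 1 + r̄ i ^ℚ 1)     ≡⟨ Σ.fold-cong h (λ i i<h →
                                                  trans (cong₂ _+_ (ℚP.*-identityʳ (r i)) (ℚP.*-identityʳ (r̄ i))) (r+r̄ (<h⇒<2h i<h))) ⟩
    Σ.fold h (λ i → P * t i)                 ≡⟨ Σ-*ˡ P h t ⟩
    P * E                                    ∎

  T₂ : ℚ
  T₂ = Σ.fold h (λ i → t i * t i)

  T₃ : ℚ
  T₃ = Σ.fold h (λ i → t i * t i * t i)

  H₃≡P³T₃-3PT₂ : invPowSum 3 (h ℕ.+ h) ≡ P * P * P * T₃ - ι 3 * P * T₂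
  H₃≡P³T₃-3PT₂ = begin
    invPowSum 3 (h ℕ.+ h)                      ≡⟨ invPowSum≡Σ 3 (h ℕ.+ h) ⟩
    Σ.fold (h ℕ.+ h) (λ i → r i ^ℚ 3)          ≡⟨ Σ.fold-pair h _ ⟩
    Σ.fold h (λ i → r i ^ℚ 3 + r̄ i ^ℚ 3)       ≡⟨ Σ.fold-cong h (λ i i<h → sum-of-cubes P (r i) (r̄ i) (r+r̄ (<h⇒<2h i<h))) ⟩
    Σ.fold h (λ i → P * P * P * (t i * t i * t i) - ι 3 * P * (t i * t i))
                                               ≡⟨ Σ-sub h _ _ ⟩
    Σ.fold h (λ i → P * P * P * (t i * t i * t i)) - Σ.fold h (λ i → ι 3 * P * (t i * t i))
                                               ≡⟨ cong₂ _-_ (Σ-*ˡ (P * P * P) h _) (Σ-*ˡ (ι 3 * P) h _) ⟩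
    P * P * P * T₃ - ι 3 * P * T₂              ∎

  module _ (α : ℚ) (α-integral : Integral α) where

    u : ℚ
    u = α * (α - 1ℚ)

    X : ℚ
    X = u * (P * P)

    y : ℕ → ℚ
    y i = X * t i

    binom≡Π[1+y] : binom (α * P - 1ℚ) (h ℕ.+ h) ≡ Π.fold h (λ i → 1ℚ + y i)
    binom≡Π[1+y] = begin
      binom (α * P - 1ℚ) (h ℕ.+ h)          ≡⟨ binom≡Π (α * P - 1ℚ) (h ℕ.+ h) ⟩
      Π.fold (h ℕ.+ h) factor               ≡⟨ Π.fold-pair h factor ⟩
      Π.fold h (λ i → factor i * factor (mirror i))
                                            ≡⟨ Π.fold-cong h (λ i i<h → paired i (<h⇒<2h i<h)) ⟩
      Π.fold h (λ i → 1ℚ + y i)             ∎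
      where
      factor : ℕ → ℚ
      factor i = (α * P - 1ℚ - ι i) * r i
      [1+ι]*r≡1 : ∀ i → (1ℚ + ι i) * r i ≡ 1ℚ
      [1+ι]*r≡1 i = trans (cong (_* r i) (sym (ι-suc i))) (ι-*-1/ i)
      paired : ∀ i → i < h ℕ.+ h → factor i * factor (mirror i) ≡ 1ℚ + y i
      paired i i<2h = paired-factors α P (ι i) (ι (mirror i)) (r i) (r̄ i)
        ([1+ι]*r≡1 i) ([1+ι]*r≡1 (mirror i))
        (trans (sym (cong₂ _+_ (ι-suc i) (ι-suc (mirror i)))) (ι-complement-sum i<2h))

    u-integral : Integral u
    u-integral = *-integral α-integral (sub-integral α-integral (ι-integral 1))

    p²∣X : p^ 2 ∣ X
    p²∣X = multiple u u-integral (cong (λ x → u * (P * x)) (sym (ℚP.*-identityʳ P)))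

    p²∣y : ∀ i → i < h → p^ 2 ∣ y i
    p²∣y i i<h = subst (p^ 2 ∣_) (ℚP.*-comm (t i) X) (p^∣-*ˡ (t-integral (<h⇒<2h i<h)) p²∣X)

    Σy≡XE : Σ.fold h y ≡ X * E
    Σy≡XE = Σ-*ˡ X h t

    e₂[y]≡ : e₂ y h ≡ ((+ 1) / 2) * (X * E * (X * E) - X * X * T₂)
    e₂[y]≡ = trans (e₂-newton y h) (cong₂ (λ a b → ((+ 1) / 2) * (a * a - b)) Σy≡XE Σy²≡)
      where
      square : ∀ X t → X * t * (X * t) ≡ X * X * (t * t)
      square = solve-∀ ℚ-ring
      Σy²≡ : Σ.fold h (λ i → y i * y i) ≡ X * X * T₂
      Σy²≡ = trans (Σ.fold-cong h (λ i _ → square X (t i))) (Σ-*ˡ (X * X) h _)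

    Π[1+y]≡1+XE+e₂ : p^ 6 ∣ Π.fold h (λ i → 1ℚ + y i) - (1ℚ + X * E + ((+ 1) / 2) * (X * E * (X * E) - X * X * T₂))
    Π[1+y]≡1+XE+e₂ = subst (λ z → p^ 6 ∣ Π.fold h (λ i → 1ℚ + y i) - z)
      (cong₂ (λ a b → 1ℚ + a + b) Σy≡XE e₂[y]≡) (Π[1+y]≡1+e₁+e₂ h p²∣y)

    LHS : ℚ
    LHS = binom (α * ι p - 1ℚ) (p ∸ 1)

    RHS : ℚ
    RHS = 1ℚ + α * (α - 1ℚ) * ι p * invPowSum 1 (p ∸ 1)
          + ((+ 1) / 6) * (α ^ℚ 2) * ((α - 1ℚ) ^ℚ 2) * (ι p ^ℚ 3) * invPowSum 3 (p ∸ 1)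

    LHS-RHS≡ : LHS - RHS ≡ (Π.fold h (λ i → 1ℚ + y i) - (1ℚ + X * E + ((+ 1) / 2) * (X * E * (X * E) - X * X * T₂)))
                           + ((+ 1) / 2) * (X * E * (X * E)) - ((+ 1) / 6) * (u * u) * T₃ * ι p ^ℚ 6
    LHS-RHS≡ = begin
      LHS - RHS
        ≡⟨ cong (_- RHS) binom≡Π[1+y] ⟩
      π - RHS
        ≡⟨ cong₂ (λ H₁ H₃ → π - (1ℚ + u * P * H₁ + ((+ 1) / 6) * (α ^ℚ 2) * ((α - 1ℚ) ^ℚ 2) * (P ^ℚ 3) * H₃)) H₁≡PE H₃≡P³T₃-3PT₂ ⟩
      π - (1ℚ + u * P * (P * E) + ((+ 1) / 6) * (α ^ℚ 2) * ((α - 1ℚ) ^ℚ 2) * (P ^ℚ 3) * (P * P * P * T₃ - ι 3 * P * T₂))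
        ≡⟨ rearrange π α P E T₂ T₃ ⟩
      (π - (1ℚ + X * E + ((+ 1) / 2) * (X * E * (X * E) - X * X * T₂)))
        + ((+ 1) / 2) * (X * E * (X * E)) - ((+ 1) / 6) * (u * u) * T₃ * P ^ℚ 6 ∎
      where
      π : ℚ
      π = Π.fold h (λ i → 1ℚ + y i)
      -- The ring solver does not see through _^ℚ_, so the powers are written unfolded.
      rearrange : ∀ π α P E T₂ T₃ → let u = α * (α - 1ℚ); X = u * (P * P) in
        π - (1ℚ + u * P * (P * E) + ((+ 1) / 6) * (α * (α * 1ℚ)) * ((α - 1ℚ) * ((α - 1ℚ) * 1ℚ))
                  * (P * (P * (P * 1ℚ))) * (P * P * P * T₃ - ι 3 * P * T₂))
        ≡ (π - (1ℚ + X * E + ((+ 1) / 2) * (X * E * (X * E) - X * X * T₂)))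
          + ((+ 1) / 2) * (X * E * (X * E)) - ((+ 1) / 6) * (u * u) * T₃ * (P * (P * (P * (P * (P * (P * 1ℚ))))))
      rearrange = solve-∀ ℚ-ring

    p⁶∣LHS-RHS : p^ 6 ∣ LHS - RHS
    p⁶∣LHS-RHS = subst (p^ 6 ∣_) (sym LHS-RHS≡) (p^∣-sub (p^∣-+ Π[1+y]≡1+XE+e₂ p⁶∣square) p⁶∣cube)
      where
      p³∣XE : p^ 3 ∣ X * E
      p³∣XE = p^∣-* p²∣X E≡0
      p⁶∣square : p^ 6 ∣ ((+ 1) / 2) * (X * E * (X * E))
      p⁶∣square = p^∣-*ˡ (/-integral (+ 1) 2 (ℕP.≤-trans (ℕP.m≤m+n 3 4) 7≤p)) (p^∣-* p³∣XE p³∣XE)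
      p⁶∣cube : p^ 6 ∣ ((+ 1) / 6) * (u * u) * T₃ * ι p ^ℚ 6
      p⁶∣cube = multiple _ (*-integral (*-integral (/-integral (+ 1) 6 7≤p) (*-integral u-integral u-integral))
                                        (Σ-integral h (λ i i<h → t³-integral (t-integral (<h⇒<2h i<h))))) refl
        where
        t³-integral : ∀ {x} → Integral x → Integral (x * x * x)
        t³-integral x-int = *-integral (*-integral x-int x-int) x-int

    RHS-integral : Integral RHS
    RHS-integral =
      +-integral (+-integral (ι-integral 1) (*-integral (*-integral u-integral (ι-integral p)) (H-integral 1)))
                 (*-integral (*-integral (*-integral (*-integral (/-integral (+ 1) 6 7≤p) (^-integral 2 α-integral))
                                                     (^-integral 2 (sub-integral α-integral (ι-integral 1))))
                                         (^-integral 3 (ι-integral p)))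
                             (H-integral 3))
      where
      H-integral : ∀ k → Integral (invPowSum k (p ∸ 1))
      H-integral k = invPowSum-integral k (h ℕ.+ h) ℕP.≤-refl

    theorem : CongMod p 6 LHS RHS
    theorem = congMod {a = LHS} RHS-integral p⁶∣LHS-RHS

corollary7 : (p : ℕ) → Prime p → 11 ≤ p → (α : ℚ) → pIntegral p α →
    CongMod p 6
      (binom (α * ι p - 1ℚ) (p ∸ 1))
      (1ℚ + α * (α - 1ℚ) * ι p * invPowSum 1 (p ∸ 1)
          + ((+ 1) / 6) * (α ^ℚ 2) * ((α - 1ℚ) ^ℚ 2) * (ι p ^ℚ 3) * invPowSum 3 (p ∸ 1))
corollary7 p p-prime 11≤p α α-integral with odd-prime p-prime (ℕP.≤-trans (ℕP.m≤m+n 3 8) 11≤p)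
... | h , refl = OddPrime.theorem h p-prime (ℕP.≤-trans (ℕP.m≤m+n 7 4) 11≤p) α (PAdic.integral α-integral)
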